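{- For every integer $m\ge1$ and every circular sequence of integers $\epsilon$ of length $s$, we have $w(\Gamma^m_\epsilon)=c(\Gamma^m_\epsilon)\cdot s$.
   Context: Digraph $\Gamma^m_\epsilon$ of a circular integer sequence $\epsilon=(\epsilon_1,\dots,\epsilon_s)$ (indices mod $s$): vertices $x_{i,t}$, $0\le i\le m-1$, $t\in\{1,\dots,s\}$, some "marked zero". If $s=1$: if $\epsilon_1\ne0$ all vertices are marked zero and there are no edges; if $\epsilon_1=0$ nothing is marked and each $x_{i,1}$ carries a loop of weight $0$. If $s\ge2$: for each $t$ let $A_t=\max(\epsilon_t,0)$, $B_t=\max(-\epsilon_{t+1},0)$; for each $j\in\{0,\dots,m-1\}$: if $j\ge\max(A_t,B_t)$ add an edge from $x_{j-A_t,t}$ to $x_{j-B_t,t+1}$ of weight $A_t-B_t$; if $A_t\le j<B_t$ mark $x_{j-A_t,t}$ zero; if $B_t\le j<A_t$ mark $x_{j-B_t,t+1}$ zero. Each connected component is a directed path (linear digraph) or a directed cycle (circular digraph). $c(\Gamma^m_\epsilon)$ is the number of circular digraphs and $w(\Gamma^m_\epsilon)$ the total number of edges in all circular digraphs. -}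

module Defs where

open import Data.Nat using (ℕ; zero; suc; _+_; _*_; _∸_; _⊔_; _<ᵇ_; _≡ᵇ_; _≤ᵇ_)
open import Data.Nat.DivMod using (_mod_)
open import Data.Fin as F using (Fin; toℕ)
open import Data.Integer as ℤ using (ℤ; +_; -[1+_]; -_)
open import Data.Bool using (Bool; true; false; _∧_; _∨_; not; if_then_else_)
open import Data.List using (List; []; _∷_; [_]; map; concatMap; upTo; allFin; length)
open import Data.Nat.ListAction using (sum)
open import Data.Bool.ListAction using (any; all)
open import Data.Product using (_×_; _,_; proj₁; proj₂)

-- A vertex x_{i,t} is encoded as the pair (i , t) with t 0-based (t ∈ {0,…,s-1}
-- corresponds to the paper's t+1 ∈ {1,…,s}).
Vertex : Set
Vertex = ℕ × ℕ

Edge : Set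
Edge = Vertex × Vertex × ℤ

src : Edge → Vertex
src (u , _ , _) = u

tgt : Edge → Vertex
tgt (_ , v , _) = v

nxt : (n : ℕ) → Fin (suc n) → Fin (suc n)
nxt n t = suc (toℕ t) mod (suc n)

posPart : ℤ → ℕ
posPart (+ k) = k
posPart -[1+ _ ] = 0

vertices : ℕ → ℕ → List Vertex
vertices m s = concatMap (λ i → map (λ t → (i , t)) (upTo s)) (upTo m)

edgesAt : ℕ → (n : ℕ) → (Fin (suc n) → ℤ) → Fin (suc n) → List Edge
edgesAt m n ε t = concatMap f (upTo m)
  where
  A : ℕ
  A = posPart (ε t)
  B : ℕ
  B = posPart (- ε (nxt n t))
  f : ℕ → List Edge
  f j = if (A ⊔ B) ≤ᵇ j
        then [ ((j ∸ A , toℕ t) , (j ∸ B , toℕ (nxt n t)) , (+ A) ℤ.- (+ B)) ]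
        else []

edges : (m n : ℕ) → (Fin (suc n) → ℤ) → List Edge
edges m zero ε with ε F.zero
... | + zero = map (λ i → ((i , 0) , (i , 0) , + 0)) (upTo m)
... | + suc _ = []
... | -[1+ _ ] = []
edges m (suc n) ε = concatMap (edgesAt m (suc n) ε) (allFin (suc (suc n)))

veq : Vertex → Vertex → Bool
veq (a , b) (c , d) = (a ≡ᵇ c) ∧ (b ≡ᵇ d)

-- lexicographic strict order, used only to pick one representative per component
lexLess : Vertex → Vertex → Bool
lexLess (a , b) (c , d) = (a <ᵇ c) ∨ ((a ≡ᵇ c) ∧ (b <ᵇ d))

count : {A : Set} → (A → Bool) → List A → ℕ
count p xs = sum (map (λ x → if p x then 1 else 0) xs)

adjacent : List Edge → Vertex → Vertex → Bool
adjacent E u v = any (λ e → (veq (src e) u ∧ veq (tgt e) v) ∨ (veq (src e) v ∧ veq (tgt e) u)) E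

reach : List Edge → List Vertex → ℕ → Vertex → Vertex → Bool
reach E V zero u v = veq u v
reach E V (suc k) u v = reach E V k u v ∨ any (λ x → adjacent E u x ∧ reach E V k x v) V

sameComp : List Vertex → List Edge → Vertex → Vertex → Bool
sameComp V E v u = reach E V (length V) v u

outdeg : List Edge → Vertex → ℕ
outdeg E v = count (λ e → veq (src e) v) E

indeg : List Edge → Vertex → ℕ
indeg E v = count (λ e → veq (tgt e) v) E

-- the connected component of v is a directed cycle (circular digraph):
-- a finite connected digraph is a directed cycle iff every vertex has
-- in-degree 1 and out-degree 1
circularComp : List Vertex → List Edge → Vertex → Bool
circularComp V E v = all (λ u → not (sameComp V E v u) ∨ ((indeg E u ≡ᵇ 1) ∧ (outdeg E u ≡ᵇ 1))) V

isRep : List Vertex → List Edge → Vertex → Bool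
isRep V E v = all (λ u → not (sameComp V E v u ∧ lexLess u v)) V

numCirc : List Vertex → List Edge → ℕ
numCirc V E = count (λ v → isRep V E v ∧ circularComp V E v) V

edgesCirc : List Vertex → List Edge → ℕ
edgesCirc V E = count (λ e → circularComp V E (src e)) E

cΓ : (m n : ℕ) → (Fin (suc n) → ℤ) → ℕ
cΓ m n ε = numCirc (vertices m (suc n)) (edges m n ε)

wΓ : (m n : ℕ) → (Fin (suc n) → ℤ) → ℕ
wΓ m n ε = edgesCirc (vertices m (suc n)) (edges m n ε)

-- For s ≥ 2 give x_{i,t} the level i − (d₁ + ⋯ + d_{t−1}), where d_t = A_t − B_t.  An edge from
-- layer t to layer t + 1 keeps the level, while an edge from layer s back to layer 1 raises it by
-- D = d₁ + ⋯ + d_s.  Every vertex of a circular component has an out-edge, so from such a vertex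
-- one can walk m·s steps and return to its layer with the level raised by m·D; since the first
-- index stays in [0, m), this forces D = 0.  When D = 0 the components lie inside level classes,
-- a level class has at most one vertex per layer, and it is a circular component exactly when each
-- layer contains a vertex of that level with an out-edge; it then has s vertices and s edges.
-- Counting level by level, every circular component contributes s edges to w and one
-- representative to c.  For s = 1 the digraph is either empty or consists of m loops.

module Submission where

open import Defs
open import Data.Nat using (ℕ; suc; _*_; _≤_)
open import Data.Fin using (Fin)
open import Data.Integer using (ℤ)
open import Relation.Binary.PropositionalEquality using (_≡_)

open import Data.Bool as Bool using (Bool; true; false; _∧_; _∨_; not; if_then_else_)
import Data.Bool.Properties as Bool
open import Data.Bool.ListAction using (any; all)
open import Data.Fin as Fin using (toℕ; fromℕ<)
import Data.Fin.Properties as Fin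
import Data.Integer as ℤ
import Data.Integer.Properties as ℤ
open import Data.Integer.Tactic.RingSolver using (solve-∀)
open import Data.List
  using (List; []; _∷_; [_]; _++_; map; concatMap; cartesianProduct; upTo; allFin; length)
import Data.List.Properties as List
open import Data.List.Membership.Propositional using (_∈_; find; lose)
open import Data.List.Membership.Propositional.Properties
  using ( ∈-map⁺; ∈-map⁻; ∈-allFin; ∈-concatMap⁺; ∈-concatMap⁻
        ; ∈-cartesianProduct⁺; ∈-cartesianProduct⁻; ∈-upTo⁺; ∈-upTo⁻)
open import Data.List.Relation.Unary.All as All using (_∷_)
open import Data.List.Relation.Unary.All.Properties using (all⁺; all⁻)
open import Data.List.Relation.Unary.AllPairs using (_∷_)
open import Data.List.Relation.Unary.Any as Any using (Any; here; there)
open import Data.List.Relation.Unary.Any.Properties using (any⁺; any⁻)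
open import Data.List.Relation.Unary.Unique.Propositional using (Unique)
import Data.List.Relation.Unary.Unique.Propositional.Properties as Unique
open import Data.Nat as ℕ using (zero; _+_; _∸_; _<_; _⊔_; _≡ᵇ_; _<ᵇ_; _≤ᵇ_; z≤n; s≤s)
import Data.Nat.Properties as ℕ
open import Algebra.Properties.CommutativeSemigroup ℕ.+-commutativeSemigroup using (interchange)
open import Data.Nat.DivMod using (_%_; _mod_; n%n≡0; m<n⇒m%n≡m; [m+kn]%n≡m%n)
open import Data.Nat.ListAction using (sum)
import Data.Nat.ListAction.Properties as Sum
open import Data.Product using (∃; _×_; _,_; proj₁; proj₂)
open import Data.Product.Relation.Binary.Lex.Strict using (×-Lex; ×-transitive; ×-irreflexive; ×-compare)
open import Data.Sum using (_⊎_; inj₁; inj₂)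
open import Function using (Equivalence)
open import Relation.Binary using (DecidableEquality; tri<; tri≈; tri>)
open import Relation.Binary.PropositionalEquality
  using (refl; sym; trans; cong; cong₂; subst; _≢_; isEquivalence; resp₂; module ≡-Reasoning)
open import Relation.Nullary using (¬_; yes; no; Dec; does; contradiction)
open import Relation.Nullary.Decidable using (decidable-stable; dec-true)
open import Relation.Unary using (Decidable)

private
  variable
    X Y : Set

∧-true⁻ : ∀ {a b} → a ∧ b ≡ true → a ≡ true × b ≡ true
∧-true⁻ {true} b≡true = refl , b≡true

∨-true⁻ : ∀ {a b} → a ∨ b ≡ true → a ≡ true ⊎ b ≡ true
∨-true⁻ {true} _ = inj₁ refl
∨-true⁻ {false} b≡true = inj₂ b≡true

does-true⁻ : ∀ {P : Set} (p? : Dec P) → does p? ≡ true → P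
does-true⁻ (yes p) _ = p

if-1-0≢0 : ∀ {b} → (if b then 1 else 0) ≢ 0 → b ≡ true
if-1-0≢0 {true} _ = refl
if-1-0≢0 {false} ≢0 = contradiction refl ≢0

≡ᵇ-true⁻ : ∀ {a b} → (a ≡ᵇ b) ≡ true → a ≡ b
≡ᵇ-true⁻ {a} {b} e = ℕ.≡ᵇ⇒≡ a b (Equivalence.from Bool.T-≡ e)

≡ᵇ-refl : ∀ a → (a ≡ᵇ a) ≡ true
≡ᵇ-refl zero = refl
≡ᵇ-refl (suc a) = ≡ᵇ-refl a

<ᵇ-true⁻ : ∀ {a b} → (a <ᵇ b) ≡ true → a < b
<ᵇ-true⁻ {a} {b} e = ℕ.<ᵇ⇒< a b (Equivalence.from Bool.T-≡ e)

<ᵇ-true⁺ : ∀ {a b} → a < b → (a <ᵇ b) ≡ true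
<ᵇ-true⁺ a<b = Equivalence.to Bool.T-≡ (ℕ.<⇒<ᵇ a<b)

any-true⁺ : ∀ (p : X → Bool) {xs x} → x ∈ xs → p x ≡ true → any p xs ≡ true
any-true⁺ p x∈ px = Equivalence.to Bool.T-≡ (any⁺ p (lose x∈ (Equivalence.from Bool.T-≡ px)))

any-true⁻ : ∀ (p : X → Bool) xs → any p xs ≡ true → ∃ λ x → x ∈ xs × p x ≡ true
any-true⁻ p xs any≡true =
  let x , x∈ , px = find (any⁻ p xs (Equivalence.from Bool.T-≡ any≡true))
  in x , x∈ , Equivalence.to Bool.T-≡ px

all-true⁺ : ∀ (p : X → Bool) xs → (∀ {x} → x ∈ xs → p x ≡ true) → all p xs ≡ true
all-true⁺ p xs p≡true =
  Equivalence.to Bool.T-≡ (all⁻ p (All.tabulate (λ x∈ → Equivalence.from Bool.T-≡ (p≡true x∈))))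

all-true⁻ : ∀ (p : X → Bool) {xs} → all p xs ≡ true → ∀ {x} → x ∈ xs → p x ≡ true
all-true⁻ p {xs} all≡true x∈ =
  Equivalence.to Bool.T-≡ (All.lookup (all⁺ p xs (Equivalence.from Bool.T-≡ all≡true)) x∈)

sum-map-cong : ∀ (xs : List X) {f g : X → ℕ} → (∀ {x} → x ∈ xs → f x ≡ g x) →
               sum (map f xs) ≡ sum (map g xs)
sum-map-cong [] _ = refl
sum-map-cong (x ∷ xs) f≗g = cong₂ _+_ (f≗g (here refl)) (sum-map-cong xs (λ y∈ → f≗g (there y∈)))

sum-map-zero : ∀ (xs : List X) {f : X → ℕ} → (∀ {x} → x ∈ xs → f x ≡ 0) → sum (map f xs) ≡ 0
sum-map-zero [] _ = refl
sum-map-zero (x ∷ xs) f≡0 = cong₂ _+_ (f≡0 (here refl)) (sum-map-zero xs (λ y∈ → f≡0 (there y∈)))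

sum-map-single : ∀ {xs : List X} {f : X → ℕ} {x₀} → Unique xs → x₀ ∈ xs →
                 (∀ {x} → x ∈ xs → f x ≢ 0 → x ≡ x₀) → sum (map f xs) ≡ f x₀
sum-map-single {xs = x ∷ xs} {f = f} (x∉xs ∷ _) (here refl) supp =
  trans (cong (f x +_) (sum-map-zero xs vanish)) (ℕ.+-identityʳ (f x))
  where
  vanish : ∀ {y} → y ∈ xs → f y ≡ 0
  vanish {y} y∈ = decidable-stable (f y ℕ.≟ 0) λ fy≢0 → All.lookup x∉xs y∈ (sym (supp (there y∈) fy≢0))
sum-map-single {xs = x ∷ xs} {f = f} (x∉xs ∷ xs!) (there x₀∈) supp =
  trans (cong (_+ sum (map f xs)) fx≡0) (sum-map-single xs! x₀∈ (λ y∈ → supp (there y∈)))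
  where
  fx≡0 : f x ≡ 0
  fx≡0 = decidable-stable (f x ℕ.≟ 0) λ fx≢0 → All.lookup x∉xs x₀∈ (supp (here refl) fx≢0)

nonzero-summand : ∀ (xs : List X) (f : X → ℕ) → sum (map f xs) ≢ 0 → ∃ λ x → x ∈ xs × f x ≢ 0
nonzero-summand [] f sum≢0 = contradiction refl sum≢0
nonzero-summand (x ∷ xs) f sum≢0 with f x ℕ.≟ 0
... | no fx≢0 = x , here refl , fx≢0
... | yes fx≡0 =
  let y , y∈ , fy≢0 = nonzero-summand xs f (λ rest≡0 → sum≢0 (cong₂ _+_ fx≡0 rest≡0))
  in y , there y∈ , fy≢0

sum-map-+ : ∀ (xs : List X) (f g : X → ℕ) →
            sum (map (λ x → f x + g x) xs) ≡ sum (map f xs) + sum (map g xs)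
sum-map-+ [] f g = refl
sum-map-+ (x ∷ xs) f g = trans (cong (f x + g x +_) (sum-map-+ xs f g)) (interchange (f x) (g x) _ _)

sum-map-*ˡ : ∀ (xs : List X) (k : ℕ) (f : X → ℕ) → sum (map (λ x → k * f x) xs) ≡ k * sum (map f xs)
sum-map-*ˡ [] k f = sym (ℕ.*-zeroʳ k)
sum-map-*ˡ (x ∷ xs) k f = trans (cong (k * f x +_) (sum-map-*ˡ xs k f)) (sym (ℕ.*-distribˡ-+ k (f x) _))

sum-map-swap : (xs : List X) (ys : List Y) (f : X → Y → ℕ) →
               sum (map (λ x → sum (map (f x) ys)) xs) ≡ sum (map (λ y → sum (map (λ x → f x y) xs)) ys)
sum-map-swap [] ys f = sym (sum-map-zero ys (λ _ → refl))
sum-map-swap (x ∷ xs) ys f =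
  trans (cong (sum (map (f x) ys) +_) (sum-map-swap xs ys f)) (sym (sum-map-+ ys (f x) _))

count-cong : ∀ (xs : List X) {p q : X → Bool} → (∀ {x} → x ∈ xs → p x ≡ q x) → count p xs ≡ count q xs
count-cong xs p≗q = sum-map-cong xs (λ x∈ → cong (λ b → if b then 1 else 0) (p≗q x∈))

count-≡0 : ∀ (xs : List X) {p : X → Bool} → (∀ {x} → x ∈ xs → p x ≡ false) → count p xs ≡ 0
count-≡0 xs p≡false = sum-map-zero xs (λ x∈ → cong (λ b → if b then 1 else 0) (p≡false x∈))

count-≡length : ∀ (xs : List X) {p : X → Bool} → (∀ {x} → x ∈ xs → p x ≡ true) → count p xs ≡ length xs
count-≡length [] _ = refl
count-≡length (x ∷ xs) p≡true rewrite p≡true (here refl) =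
  cong suc (count-≡length xs (λ y∈ → p≡true (there y∈)))

count-≡1 : ∀ {xs : List X} {p : X → Bool} {x₀} → Unique xs → x₀ ∈ xs → p x₀ ≡ true →
           (∀ {x} → x ∈ xs → p x ≡ true → x ≡ x₀) → count p xs ≡ 1
count-≡1 xs! x₀∈ px₀ supp =
  trans (sum-map-single xs! x₀∈ (λ x∈ ≢0 → supp x∈ (if-1-0≢0 ≢0))) (cong (λ b → if b then 1 else 0) px₀)

count-concatMap : (p : Y → Bool) (f : X → List Y) (xs : List X) →
                  count p (concatMap f xs) ≡ sum (map (λ x → count p (f x)) xs)
count-concatMap p f [] = refl
count-concatMap p f (x ∷ xs) = begin
  count p (f x ++ concatMap f xs)                    ≡⟨ cong sum (List.map-++ _ (f x) (concatMap f xs)) ⟩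
  sum (map _ (f x) ++ map _ (concatMap f xs))        ≡⟨ Sum.sum-++ (map _ (f x)) _ ⟩
  count p (f x) + count p (concatMap f xs)           ≡⟨ cong (count p (f x) +_) (count-concatMap p f xs) ⟩
  count p (f x) + sum (map (λ x → count p (f x)) xs) ∎
  where open ≡-Reasoning

count-map : (p : Y → Bool) (f : X → Y) (xs : List X) → count p (map f xs) ≡ count (λ x → p (f x)) xs
count-map p f xs = cong sum (sym (List.map-∘ xs))

count-fibres : ∀ {K : Set} (_≟ᴷ_ : DecidableEquality K) (κ : X → K) {ks : List K} → Unique ks →
               (p : X → Bool) (xs : List X) → (∀ {x} → x ∈ xs → p x ≡ true → κ x ∈ ks) →
               count p xs ≡ sum (map (λ k → count (λ x → p x ∧ does (κ x ≟ᴷ k)) xs) ks)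
count-fibres _≟ᴷ_ κ {ks} ks! p xs κ∈ks = trans (sum-map-cong xs split) (sum-map-swap xs ks _)
  where
  split : ∀ {x} → x ∈ xs → (if p x then 1 else 0) ≡ count (λ k → p x ∧ does (κ x ≟ᴷ k)) ks
  split {x} x∈ with p x in px
  ... | false = sym (count-≡0 ks (λ _ → refl))
  ... | true = sym (count-≡1 ks! (κ∈ks x∈ px) (dec-true (κ x ≟ᴷ κ x) refl)
                     (λ {k} _ κx≟k → sym (does-true⁻ (κ x ≟ᴷ k) κx≟k)))

module _ {_≺_ : X → X → Set} (_≺?_ : ∀ x y → Dec (x ≺ y))
         (≺-irrefl : ∀ {x} → ¬ x ≺ x) (≺-trans : ∀ {x y z} → x ≺ y → y ≺ z → x ≺ z) where

  minimal : ∀ {P : X → Set} → Decidable P → ∀ {xs} → Any P xs →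
            ∃ λ y → y ∈ xs × P y × (∀ {z} → z ∈ xs → P z → ¬ z ≺ y)
  minimal P? {y ∷ ys} Pxs with P? y | Any.any? P? ys
  ... | no ¬Py | no ¬Pys = contradiction Pxs λ { (here Py) → ¬Py Py ; (there Pys) → ¬Pys Pys }
  ... | no ¬Py | yes Pys =
    let x , x∈ , Px , x-min = minimal P? Pys
    in x , there x∈ , Px , λ { (here refl) Py → contradiction Py ¬Py ; (there z∈) → x-min z∈ }
  ... | yes Py | no ¬Pys =
    y , here refl , Py , λ { (here refl) _ → ≺-irrefl ; (there z∈) Pz _ → ¬Pys (lose z∈ Pz) }
  ... | yes Py | yes Pys with minimal P? Pys
  ...   | x , x∈ , Px , x-min with y ≺? x
  ...     | yes y≺x = y , here refl , Py ,
                      λ { (here refl) _ → ≺-irrefl ; (there z∈) Pz z≺y → x-min z∈ Pz (≺-trans z≺y y≺x) }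
  ...     | no y⊀x = x , there x∈ , Px , λ { (here refl) _ → y⊀x ; (there z∈) → x-min z∈ }

_⊏_ : Vertex → Vertex → Set
_⊏_ = ×-Lex _≡_ _<_ _<_

lexLess⇒⊏ : ∀ u v → lexLess u v ≡ true → u ⊏ v
lexLess⇒⊏ (a , b) (c , d) u<v with ∨-true⁻ {a <ᵇ c} u<v
... | inj₁ a<c = inj₁ (<ᵇ-true⁻ a<c)
... | inj₂ a≡c∧b<d = let a≡c , b<d = ∧-true⁻ {a ≡ᵇ c} a≡c∧b<d in inj₂ (≡ᵇ-true⁻ a≡c , <ᵇ-true⁻ b<d)

⊏⇒lexLess : ∀ u v → u ⊏ v → lexLess u v ≡ true
⊏⇒lexLess (a , b) (c , d) (inj₁ a<c) rewrite <ᵇ-true⁺ a<c = refl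
⊏⇒lexLess (a , b) (c , d) (inj₂ (refl , b<d)) rewrite <ᵇ-true⁺ b<d | ≡ᵇ-refl a = Bool.∨-zeroʳ (a <ᵇ a)

lexLess-irrefl : ∀ u → lexLess u u ≢ true
lexLess-irrefl u u<u =
  ×-irreflexive {_≈₁_ = _≡_} {_<₁_ = _<_} {_≈₂_ = _≡_} {_<₂_ = _<_}
                ℕ.<-irrefl ℕ.<-irrefl (refl , refl) (lexLess⇒⊏ u u u<u)

lexLess-trans : ∀ {u v w} → lexLess u v ≡ true → lexLess v w ≡ true → lexLess u w ≡ true
lexLess-trans {u} {v} {w} u<v v<w =
  ⊏⇒lexLess u w (×-transitive {_<₂_ = _<_} isEquivalence (resp₂ _<_) ℕ.<-trans ℕ.<-trans
                               (lexLess⇒⊏ u v u<v) (lexLess⇒⊏ v w v<w))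

lexLess-tri : ∀ u v → lexLess u v ≢ true → lexLess v u ≢ true → u ≡ v
lexLess-tri u v u≮v v≮u with ×-compare sym ℕ.<-cmp ℕ.<-cmp u v
... | tri< u⊏v _ _ = contradiction (⊏⇒lexLess u v u⊏v) u≮v
... | tri≈ _ (u₁≡v₁ , u₂≡v₂) _ = cong₂ _,_ u₁≡v₁ u₂≡v₂
... | tri> _ _ v⊏u = contradiction (⊏⇒lexLess v u v⊏u) v≮u

lexLess-minimal : ∀ {P : Vertex → Set} → Decidable P → ∀ {xs} → Any P xs →
                  ∃ λ y → y ∈ xs × P y × (∀ {z} → z ∈ xs → P z → lexLess z y ≢ true)
lexLess-minimal =
  minimal (λ u v → lexLess u v Bool.≟ true) (λ {u} → lexLess-irrefl u)
          (λ {u} {v} {w} → lexLess-trans {u} {v} {w})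

concatMap-pairs≡cartesianProduct : ∀ (xs : List X) (ys : List Y) →
                                   concatMap (λ x → map (λ y → (x , y)) ys) xs ≡ cartesianProduct xs ys
concatMap-pairs≡cartesianProduct [] ys = refl
concatMap-pairs≡cartesianProduct (x ∷ xs) ys =
  cong (map (x ,_) ys ++_) (concatMap-pairs≡cartesianProduct xs ys)

length-cartesianProduct : ∀ (xs : List X) (ys : List Y) →
                          length (cartesianProduct xs ys) ≡ length xs * length ys
length-cartesianProduct [] ys = refl
length-cartesianProduct (x ∷ xs) ys =
  trans (List.length-++ (map (x ,_) ys)) (cong₂ _+_ (List.length-map (x ,_) ys) (length-cartesianProduct xs ys))

vertices≡cartesianProduct : ∀ m s → vertices m s ≡ cartesianProduct (upTo m) (upTo s)
vertices≡cartesianProduct m s = concatMap-pairs≡cartesianProduct (upTo m) (upTo s)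

∈-vertices⁻ : ∀ {m s i t} → (i , t) ∈ vertices m s → i < m × t < s
∈-vertices⁻ {m} {s} it∈ =
  let i∈ , t∈ = ∈-cartesianProduct⁻ (upTo m) (upTo s) (subst (_ ∈_) (vertices≡cartesianProduct m s) it∈)
  in ∈-upTo⁻ i∈ , ∈-upTo⁻ t∈

∈-vertices⁺ : ∀ {m s i t} → i < m → t < s → (i , t) ∈ vertices m s
∈-vertices⁺ {m} {s} i<m t<s =
  subst (_ ∈_) (sym (vertices≡cartesianProduct m s)) (∈-cartesianProduct⁺ (∈-upTo⁺ i<m) (∈-upTo⁺ t<s))

vertices-unique : ∀ m s → Unique (vertices m s)
vertices-unique m s =
  subst Unique (sym (vertices≡cartesianProduct m s)) (Unique.cartesianProduct⁺ (Unique.upTo⁺ m) (Unique.upTo⁺ s))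

length-vertices : ∀ m s → length (vertices m s) ≡ m * s
length-vertices m s = begin
  length (vertices m s)                       ≡⟨ cong length (vertices≡cartesianProduct m s) ⟩
  length (cartesianProduct (upTo m) (upTo s)) ≡⟨ length-cartesianProduct (upTo m) (upTo s) ⟩
  length (upTo m) * length (upTo s)           ≡⟨ cong₂ _*_ (List.length-upTo m) (List.length-upTo s) ⟩
  m * s                                       ∎
  where open ≡-Reasoning

veq⇒≡ : ∀ {u v} → veq u v ≡ true → u ≡ v
veq⇒≡ {a , b} {c , d} a≡c∧b≡d =
  let a≡c , b≡d = ∧-true⁻ {a ≡ᵇ c} a≡c∧b≡d in cong₂ _,_ (≡ᵇ-true⁻ a≡c) (≡ᵇ-true⁻ b≡d)

≡⇒veq : ∀ {u v} → u ≡ v → veq u v ≡ true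
≡⇒veq {a , b} refl rewrite ≡ᵇ-refl a | ≡ᵇ-refl b = refl

module Reachability (V : List Vertex) (E : List Edge) where

  reach-refl : ∀ k u → reach E V k u u ≡ true
  reach-refl zero u = ≡⇒veq {u} refl
  reach-refl (suc k) u rewrite reach-refl k u = refl

  reach-+ : ∀ r {k u v} → reach E V k u v ≡ true → reach E V (r + k) u v ≡ true
  reach-+ zero uv = uv
  reach-+ (suc r) {k} {u} {v} uv rewrite reach-+ r {k} {u} {v} uv = refl

  reach-mono : ∀ {k k′ u v} → k ≤ k′ → reach E V k u v ≡ true → reach E V k′ u v ≡ true
  reach-mono {k} {k′} k≤k′ uv = subst (λ l → reach E V l _ _ ≡ true) (ℕ.m∸n+n≡m k≤k′) (reach-+ (k′ ∸ k) uv)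

  reach-cons : ∀ {k u x v} → adjacent E u x ≡ true → x ∈ V → reach E V k x v ≡ true →
               reach E V (suc k) u v ≡ true
  reach-cons {k} {u} {x} {v} ux x∈ xv =
    trans (cong (reach E V k u v ∨_) (any-true⁺ (λ y → adjacent E u y ∧ reach E V k y v) x∈ (cong₂ _∧_ ux xv)))
          (Bool.∨-zeroʳ _)

  reach-invariant : ∀ {Z : Set} (f : Vertex → Z) → (∀ {u v} → adjacent E u v ≡ true → f u ≡ f v) →
                    ∀ k {u v} → reach E V k u v ≡ true → f u ≡ f v
  reach-invariant f adj-inv zero uv = cong f (veq⇒≡ uv)
  reach-invariant f adj-inv (suc k) {u} {v} uv with ∨-true⁻ {reach E V k u v} uv
  ... | inj₁ uv′ = reach-invariant f adj-inv k uv′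
  ... | inj₂ via =
    let x , _ , ux∧xv = any-true⁻ _ V via
        ux , xv = ∧-true⁻ {adjacent E u x} ux∧xv
    in trans (adj-inv ux) (reach-invariant f adj-inv k xv)

  circularComp⇒degrees : ∀ {v u} → circularComp V E v ≡ true → u ∈ V → sameComp V E v u ≡ true →
                         indeg E u ≡ 1 × outdeg E u ≡ 1
  circularComp⇒degrees {v} {u} circ u∈ vu with all-true⁻ _ circ u∈
  ... | degrees rewrite vu =
    let in≡1 , out≡1 = ∧-true⁻ {indeg E u ≡ᵇ 1} degrees in ≡ᵇ-true⁻ in≡1 , ≡ᵇ-true⁻ out≡1

  degrees⇒circularComp : ∀ {v} → (∀ {u} → u ∈ V → sameComp V E v u ≡ true → indeg E u ≡ 1 × outdeg E u ≡ 1) →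
                         circularComp V E v ≡ true
  degrees⇒circularComp {v} degrees = all-true⁺ _ V component-degrees
    where
    component-degrees : ∀ {u} → u ∈ V → not (sameComp V E v u) ∨ ((indeg E u ≡ᵇ 1) ∧ (outdeg E u ≡ᵇ 1)) ≡ true
    component-degrees {u} u∈ with sameComp V E v u in vu
    ... | false = refl
    ... | true rewrite proj₁ (degrees u∈ vu) | proj₂ (degrees u∈ vu) = refl

  isRep⇒ : ∀ {v u} → isRep V E v ≡ true → u ∈ V → sameComp V E v u ≡ true → lexLess u v ≢ true
  isRep⇒ {v} {u} rep u∈ vu u<v with all-true⁻ _ rep u∈
  ... | not-smaller rewrite vu | u<v = contradiction not-smaller λ ()

  isRep⁺ : ∀ {v} → (∀ {u} → u ∈ V → sameComp V E v u ≡ true → lexLess u v ≢ true) → isRep V E v ≡ true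
  isRep⁺ {v} least-in-component = all-true⁺ _ V not-smaller
    where
    not-smaller : ∀ {u} → u ∈ V → not (sameComp V E v u ∧ lexLess u v) ≡ true
    not-smaller {u} u∈ with sameComp V E v u in vu | lexLess u v in u<v
    ... | false | _ = refl
    ... | true | false = refl
    ... | true | true = contradiction u<v (least-in-component u∈ vu)

  count-representatives : Unique V → (q : Vertex → Bool) → Any (λ v → q v ≡ true) V →
    (∀ {u v} → u ∈ V → v ∈ V → q u ≡ true → q v ≡ true → sameComp V E u v ≡ true) →
    (∀ {u v} → u ∈ V → v ∈ V → q u ≡ true → sameComp V E u v ≡ true → q v ≡ true) →
    count (λ v → isRep V E v ∧ q v) V ≡ 1
  count-representatives V! q nonempty connected closed
    with r , r∈ , qr , r-least ← lexLess-minimal (λ v → q v Bool.≟ true) nonempty =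
    count-≡1 V! r∈ (cong₂ _∧_ (isRep⁺ (λ u∈ ru → r-least u∈ (closed r∈ u∈ qr ru))) qr) only-r
    where
    only-r : ∀ {v} → v ∈ V → isRep V E v ∧ q v ≡ true → v ≡ r
    only-r {v} v∈ rep∧q =
      let rep , qv = ∧-true⁻ {isRep V E v} rep∧q
      in lexLess-tri v r (r-least v∈ qv) (isRep⇒ rep r∈ (connected v∈ r∈ qv qr))

quotient-remainder-unique : ∀ {s} .{{_ : ℕ.NonZero s}} {w w′ a b} →
                            w * s + a ≡ w′ * s + b → a < s → b < s → w ≡ w′ × a ≡ b
quotient-remainder-unique {s} {w} {w′} {a} {b} eq a<s b<s = w≡w′ , a≡b
  where
  remainder : ∀ {q r} → r < s → (q * s + r) % s ≡ r
  remainder {q} {r} r<s = trans (cong (_% s) (ℕ.+-comm (q * s) r)) (trans ([m+kn]%n≡m%n r q s) (m<n⇒m%n≡m r<s))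
  a≡b : a ≡ b
  a≡b = trans (sym (remainder {w} a<s)) (trans (cong (_% s) eq) (remainder {w′} b<s))
  w≡w′ : w ≡ w′
  w≡w′ = ℕ.*-cancelʳ-≡ w w′ s (ℕ.+-cancelʳ-≡ b (w * s) (w′ * s) (trans (cong (w * s +_) (sym a≡b)) eq))

residue-gap : ∀ {s a b} → a < s → b < s → ∃ λ k → k < s × ∃ λ w → w * s + b ≡ a + k
residue-gap {s} {a} {b} a<s b<s with a ℕ.≤? b
... | yes a≤b = b ∸ a , ℕ.≤-<-trans (ℕ.m∸n≤m b a) b<s , 0 , sym (ℕ.m+[n∸m]≡n a≤b)
... | no a≰b = b + s ∸ a , gap<s , 1 , trans (cong (_+ b) (ℕ.+-identityʳ s)) (trans (ℕ.+-comm s b) (sym a+gap))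
  where
  a≤b+s : a ≤ b + s
  a≤b+s = ℕ.≤-trans (ℕ.<⇒≤ a<s) (ℕ.m≤n+m s b)
  a+gap : a + (b + s ∸ a) ≡ b + s
  a+gap = ℕ.m+[n∸m]≡n a≤b+s
  gap<s : b + s ∸ a < s
  gap<s = subst (b + s ∸ a <_) (ℕ.m+n∸m≡n b s) (ℕ.∸-monoʳ-< (ℕ.≰⇒> a≰b) a≤b+s)

-- The case s = 1

module SingleTerm (m : ℕ) where

  open Data.Integer using (+_)
  open Reachability

  V : List Vertex
  V = vertices m 1

  ∈V⁻ : ∀ {u} → u ∈ V → ∃ λ i → i < m × u ≡ (i , 0)
  ∈V⁻ {i , t} it∈ with ∈-vertices⁻ {m} {1} it∈
  ... | i<m , s≤s z≤n = i , i<m , refl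

  no-edges : edgesCirc V [] ≡ numCirc V [] * 1
  no-edges = sym (trans (ℕ.*-identityʳ _) (count-≡0 V (λ v∈ → Bool.¬-not (not-circular v∈))))
    where
    not-circular : ∀ {v} → v ∈ V → isRep V [] v ∧ circularComp V [] v ≢ true
    not-circular {v} v∈ rep∧circ
      with () ← proj₁ (circularComp⇒degrees V [] (proj₂ (∧-true⁻ {isRep V [] v} rep∧circ)) v∈
                                              (reach-refl V [] (length V) v))

  loop : ℕ → Edge
  loop i = ((i , 0) , (i , 0) , + 0)

  loops : List Edge
  loops = map loop (upTo m)

  loop-degree : ∀ {v} → v ∈ V → count (λ j → veq (j , 0) v) (upTo m) ≡ 1
  loop-degree v∈ with i , i<m , refl ← ∈V⁻ v∈ =
    count-≡1 (Unique.upTo⁺ m) (∈-upTo⁺ i<m) (≡⇒veq {i , 0} refl)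
             (λ {j} _ ji → cong proj₁ (veq⇒≡ {j , 0} {i , 0} ji))

  loop-adjacent⇒≡ : ∀ {u v} → adjacent loops u v ≡ true → u ≡ v
  loop-adjacent⇒≡ {u} {v} uv with any-true⁻ _ loops uv
  ... | e , e∈ , joins with ∈-map⁻ loop e∈
  ...   | j , _ , refl with ∨-true⁻ {veq (j , 0) u ∧ veq (j , 0) v} joins
  ...     | inj₁ ju∧jv = let ju , jv = ∧-true⁻ {veq (j , 0) u} ju∧jv in
                         trans (sym (veq⇒≡ {j , 0} ju)) (veq⇒≡ {j , 0} jv)
  ...     | inj₂ jv∧ju = let jv , ju = ∧-true⁻ {veq (j , 0) v} jv∧ju in
                         trans (sym (veq⇒≡ {j , 0} ju)) (veq⇒≡ {j , 0} jv)

  loop-circular : ∀ {v} → v ∈ V → circularComp V loops v ≡ true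
  loop-circular _ = degrees⇒circularComp V loops λ {u} u∈ _ →
    trans (count-map (λ e → veq (tgt e) u) loop (upTo m)) (loop-degree u∈) ,
    trans (count-map (λ e → veq (src e) u) loop (upTo m)) (loop-degree u∈)

  loop-representative : ∀ {v} → v ∈ V → isRep V loops v ≡ true
  loop-representative {v} _ = isRep⁺ V loops λ {u} _ vu →
    subst (λ w → lexLess w v ≢ true) (reach-invariant V loops (λ w → w) loop-adjacent⇒≡ (length V) vu)
          (lexLess-irrefl v)

  with-loops : edgesCirc V loops ≡ numCirc V loops * 1
  with-loops = begin
    edgesCirc V loops    ≡⟨ count-≡length loops loop-source-circular ⟩
    length loops         ≡⟨ trans (List.length-map loop (upTo m)) (List.length-upTo m) ⟩
    m                    ≡⟨ trans (length-vertices m 1) (ℕ.*-identityʳ m) ⟨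
    length V             ≡⟨ count-≡length V (λ v∈ → cong₂ _∧_ (loop-representative v∈) (loop-circular v∈)) ⟨
    numCirc V loops      ≡⟨ ℕ.*-identityʳ _ ⟨
    numCirc V loops * 1  ∎
    where
    open ≡-Reasoning
    loop-source-circular : ∀ {e} → e ∈ loops → circularComp V loops (src e) ≡ true
    loop-source-circular e∈ with j , j∈ , refl ← ∈-map⁻ loop e∈ =
      loop-circular (∈-vertices⁺ (∈-upTo⁻ j∈) (s≤s z≤n))

-- The case s ≥ 2

module LongSequence (m k : ℕ) (ε : Fin (suc (suc k)) → ℤ) where

  open Data.Integer using (+_; -_)

  n : ℕ
  n = suc k

  s : ℕ
  s = suc n

  A : Fin s → ℕ
  A T = posPart (ε T)

  B : Fin s → ℕ
  B T = posPart (- ε (nxt n T))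

  V : List Vertex
  V = vertices m s

  E : List Edge
  E = edges m n ε

  open Reachability V E

  Point : Set
  Point = ℕ × Fin s

  emb : Point → Vertex
  emb (i , T) = (i , toℕ T)

  emb-injective : ∀ {x y} → emb x ≡ emb y → x ≡ y
  emb-injective {i , T} {i′ , U} eq
    with refl ← cong proj₁ eq | refl ← Fin.toℕ-injective {i = T} {j = U} (cong proj₂ eq) = refl

  ∈V⁻ : ∀ {u} → u ∈ V → ∃ λ x → proj₁ x < m × u ≡ emb x
  ∈V⁻ {i , t} it∈ =
    let i<m , t<s = ∈-vertices⁻ {m} {s} it∈
    in (i , fromℕ< t<s) , i<m , cong (λ t′ → (i , t′)) (sym (Fin.toℕ-fromℕ< t<s))

  ∈V⁺ : ∀ {x} → proj₁ x < m → emb x ∈ V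
  ∈V⁺ {i , T} i<m = ∈-vertices⁺ i<m (Fin.toℕ<n T)

  toℕ-mod : ∀ {a} → a < s → toℕ (a mod s) ≡ a
  toℕ-mod a<s = trans (Fin.toℕ-fromℕ< _) (m<n⇒m%n≡m a<s)

  mod-toℕ : ∀ T → toℕ T mod s ≡ T
  mod-toℕ T = Fin.toℕ-injective (toℕ-mod (Fin.toℕ<n T))

  inner-or-last : ∀ (T : Fin s) → toℕ T < n ⊎ toℕ T ≡ n
  inner-or-last T = ℕ.m≤n⇒m<n∨m≡n (ℕ.<⇒≤pred (Fin.toℕ<n T))

  toℕ-nxt : ∀ {T} → toℕ T < n → toℕ (nxt n T) ≡ suc (toℕ T)
  toℕ-nxt T<n = toℕ-mod (s≤s T<n)

  toℕ-nxt-last : ∀ {T} → toℕ T ≡ n → toℕ (nxt n T) ≡ 0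
  toℕ-nxt-last T≡n rewrite T≡n = trans (Fin.toℕ-fromℕ< _) (n%n≡0 s)

  nxt-injective : ∀ {T U} → nxt n T ≡ nxt n U → T ≡ U
  nxt-injective {T} {U} eq with inner-or-last T | inner-or-last U
  ... | inj₁ T<n | inj₁ U<n =
    Fin.toℕ-injective (ℕ.suc-injective (trans (sym (toℕ-nxt T<n)) (trans (cong toℕ eq) (toℕ-nxt U<n))))
  ... | inj₁ T<n | inj₂ U≡n =
    contradiction (trans (sym (toℕ-nxt T<n)) (trans (cong toℕ eq) (toℕ-nxt-last U≡n))) ℕ.1+n≢0
  ... | inj₂ T≡n | inj₁ U<n =
    contradiction (trans (sym (toℕ-nxt U<n)) (trans (cong toℕ (sym eq)) (toℕ-nxt-last T≡n))) ℕ.1+n≢0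
  ... | inj₂ T≡n | inj₂ U≡n = Fin.toℕ-injective (trans T≡n (sym U≡n))

  nxt-surjective : ∀ U → ∃ λ T → nxt n T ≡ U
  nxt-surjective Fin.zero = Fin.fromℕ n , Fin.toℕ-injective (toℕ-nxt-last (Fin.toℕ-fromℕ n))
  nxt-surjective (Fin.suc U) =
    Fin.inject₁ U , Fin.toℕ-injective (trans (toℕ-nxt inner) (cong suc (Fin.toℕ-inject₁ U)))
    where
    inner : toℕ (Fin.inject₁ U) < n
    inner = subst (_< n) (sym (Fin.toℕ-inject₁ U)) (Fin.toℕ<n U)

  -- Defs numbers the edges leaving layer T by j, as the paper does; the edge numbered j starts at
  -- x_{j − A_T, T}.  Here an edge is named by its source (i , T) instead, so that j = i + A_T.
  HasEdge : Point → Set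
  HasEdge (i , T) = B T ≤ i + A T × i + A T < m

  hasEdge? : ∀ x → Dec (HasEdge x)
  hasEdge? (i , T) with B T ℕ.≤? i + A T | i + A T ℕ.<? m
  ... | yes b | yes a = yes (b , a)
  ... | no ¬b | _ = no (λ h → ¬b (proj₁ h))
  ... | yes _ | no ¬a = no (λ h → ¬a (proj₂ h))

  step : Point → Point
  step (i , T) = (i + A T ∸ B T , nxt n T)

  edgeAt : Fin s → ℕ → Edge
  edgeAt T j = ((j ∸ A T , toℕ T) , (j ∸ B T , toℕ (nxt n T)) , + A T ℤ.- + B T)

  edgesFrom : Fin s → ℕ → List Edge
  edgesFrom T j = if A T ⊔ B T ≤ᵇ j then [ edgeAt T j ] else []

  edgeFrom : Point → Edge
  edgeFrom (i , T) = edgeAt T (i + A T)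

  src-edgeFrom : ∀ x → src (edgeFrom x) ≡ emb x
  src-edgeFrom (i , T) = cong (λ i′ → (i′ , toℕ T)) (ℕ.m+n∸n≡m i (A T))

  source-index< : ∀ {x} → HasEdge x → proj₁ x < m
  source-index< {i , T} (_ , i+A<m) = ℕ.≤-<-trans (ℕ.m≤m+n i (A T)) i+A<m

  step-index< : ∀ {x} → HasEdge x → proj₁ (step x) < m
  step-index< {i , T} (_ , i+A<m) = ℕ.≤-<-trans (ℕ.m∸n≤m (i + A T) (B T)) i+A<m

  HasEdge⇒guard : ∀ {i T} → HasEdge (i , T) → A T ⊔ B T ≤ i + A T
  HasEdge⇒guard {i} {T} (B≤ , _) = ℕ.⊔-lub (ℕ.m≤n+m (A T) i) B≤

  guard⇒HasEdge : ∀ {T j} → A T ⊔ B T ≤ j → j < m → HasEdge (j ∸ A T , T) × j ≡ j ∸ A T + A T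
  guard⇒HasEdge {T} {j} guard j<m = (subst (B T ≤_) j≡ B≤j , subst (_< m) j≡ j<m) , j≡
    where
    j≡ : j ≡ j ∸ A T + A T
    j≡ = sym (ℕ.m∸n+n≡m (ℕ.≤-trans (ℕ.m≤m⊔n (A T) (B T)) guard))
    B≤j : B T ≤ j
    B≤j = ℕ.≤-trans (ℕ.m≤n⊔m (A T) (B T)) guard

  guard-true : ∀ {T j} → A T ⊔ B T ≤ j → (A T ⊔ B T ≤ᵇ j) ≡ true
  guard-true guard = Equivalence.to Bool.T-≡ (ℕ.≤⇒≤ᵇ guard)

  count-edgesFrom : ∀ p {T j} → A T ⊔ B T ≤ j → count p (edgesFrom T j) ≡ (if p (edgeAt T j) then 1 else 0)
  count-edgesFrom p guard rewrite guard-true guard = ℕ.+-identityʳ _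

  count-edgesFrom≢0 : ∀ p {T j} → count p (edgesFrom T j) ≢ 0 → A T ⊔ B T ≤ j × p (edgeAt T j) ≡ true
  count-edgesFrom≢0 p {T} {j} ≢0 with A T ⊔ B T ≤ᵇ j in guard
  ... | false = contradiction refl ≢0
  ... | true = ℕ.≤ᵇ⇒≤ _ _ (Equivalence.from Bool.T-≡ guard) , if-1-0≢0 (λ eq → ≢0 (trans (ℕ.+-identityʳ _) eq))

  ∈E⁺ : ∀ {x} → HasEdge x → edgeFrom x ∈ E
  ∈E⁺ {i , T} h =
    ∈-concatMap⁺ (edgesAt m n ε) {allFin s}
      (lose (∈-allFin T) (∈-concatMap⁺ (edgesFrom T) {upTo m} (lose (∈-upTo⁺ (proj₂ h)) listed)))
    where
    listed : edgeFrom (i , T) ∈ edgesFrom T (i + A T)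
    listed rewrite guard-true (HasEdge⇒guard h) = here refl

  ∈E⁻ : ∀ {e} → e ∈ E → ∃ λ x → HasEdge x × e ≡ edgeFrom x
  ∈E⁻ {e} e∈ with T , _ , e∈T ← find (∈-concatMap⁻ (edgesAt m n ε) {allFin s} e∈)
              with j , j∈ , e∈Tj ← find (∈-concatMap⁻ (edgesFrom T) {upTo m} e∈T)
              with A T ⊔ B T ≤ᵇ j in guard
  ... | true with here refl ← e∈Tj =
    let h , j≡ = guard⇒HasEdge (ℕ.≤ᵇ⇒≤ _ _ (Equivalence.from Bool.T-≡ guard)) (∈-upTo⁻ j∈)
    in (j ∸ A T , T) , h , cong (edgeAt T) j≡

  adjacent-step : ∀ {x} → HasEdge x → adjacent E (emb x) (emb (step x)) ≡ true
  adjacent-step {x} h =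
    any-true⁺ _ (∈E⁺ h) (cong (_∨ (veq (src e) (emb (step x)) ∧ veq (tgt e) (emb x)))
                              (cong₂ _∧_ (≡⇒veq (src-edgeFrom x)) (≡⇒veq {emb (step x)} refl)))
    where
    e : Edge
    e = edgeFrom x

  adjacent⇒step : ∀ {u v} → adjacent E u v ≡ true →
                  ∃ λ x → HasEdge x × (u ≡ emb x × v ≡ emb (step x) ⊎ v ≡ emb x × u ≡ emb (step x))
  adjacent⇒step {u} {v} uv with any-true⁻ _ E uv
  ... | e , e∈ , joins with x , h , refl ← ∈E⁻ e∈
                       with ∨-true⁻ {veq (src (edgeFrom x)) u ∧ veq (emb (step x)) v} joins
  ...   | inj₁ forward = let xu , sv = ∧-true⁻ {veq (src (edgeFrom x)) u} forward in
          x , h , inj₁ (trans (sym (veq⇒≡ xu)) (src-edgeFrom x) , sym (veq⇒≡ {emb (step x)} sv))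
  ...   | inj₂ backward = let xv , su = ∧-true⁻ {veq (src (edgeFrom x)) v} backward in
          x , h , inj₂ (trans (sym (veq⇒≡ xv)) (src-edgeFrom x) , sym (veq⇒≡ {emb (step x)} su))

  layer-count : (Edge → Bool) → Fin s → ℕ
  layer-count p T = count p (edgesAt m n ε T)

  count-E : ∀ p → count p E ≡ sum (map (layer-count p) (allFin s))
  count-E p = count-concatMap p (edgesAt m n ε) (allFin s)

  layer-count≢0 : ∀ p {T} → layer-count p T ≢ 0 → ∃ λ i → HasEdge (i , T) × p (edgeFrom (i , T)) ≡ true
  layer-count≢0 p {T} ≢0
    with j , j∈ , j≢0 ← nonzero-summand (upTo m) _ (λ eq → ≢0 (trans (count-concatMap p (edgesFrom T) (upTo m)) eq))
    with guard , pj ← count-edgesFrom≢0 p j≢0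
    with h , j≡ ← guard⇒HasEdge guard (∈-upTo⁻ j∈)
    = j ∸ A T , h , subst (λ j′ → p (edgeAt T j′) ≡ true) j≡ pj

  layer-count≡1 : ∀ p {T i₀} → HasEdge (i₀ , T) → p (edgeFrom (i₀ , T)) ≡ true →
                  (∀ {i} → HasEdge (i , T) → p (edgeFrom (i , T)) ≡ true → i ≡ i₀) → layer-count p T ≡ 1
  layer-count≡1 p {T} {i₀} h₀ p₀ unique = begin
    layer-count p T                                    ≡⟨ count-concatMap p (edgesFrom T) (upTo m) ⟩
    sum (map (λ j → count p (edgesFrom T j)) (upTo m)) ≡⟨ sum-map-single (Unique.upTo⁺ m) (∈-upTo⁺ (proj₂ h₀))
                                                                         only-j₀ ⟩
    count p (edgesFrom T (i₀ + A T))                   ≡⟨ count-edgesFrom p (HasEdge⇒guard h₀) ⟩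
    (if p (edgeFrom (i₀ , T)) then 1 else 0)           ≡⟨ cong (λ b → if b then 1 else 0) p₀ ⟩
    1                                                  ∎
    where
    open ≡-Reasoning
    only-j₀ : ∀ {j} → j ∈ upTo m → count p (edgesFrom T j) ≢ 0 → j ≡ i₀ + A T
    only-j₀ {j} j∈ ≢0 =
      let guard , pj = count-edgesFrom≢0 p ≢0
          h , j≡ = guard⇒HasEdge guard (∈-upTo⁻ j∈)
      in trans j≡ (cong (λ i → i + A T) (unique h (subst (λ j′ → p (edgeAt T j′) ≡ true) j≡ pj)))

  count-E≡1 : ∀ p {x₀} → HasEdge x₀ → p (edgeFrom x₀) ≡ true →
              (∀ {x} → HasEdge x → p (edgeFrom x) ≡ true → x ≡ x₀) → count p E ≡ 1
  count-E≡1 p {i₀ , T₀} h₀ p₀ unique = begin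
    count p E                                ≡⟨ count-E p ⟩
    sum (map (layer-count p) (allFin s))     ≡⟨ sum-map-single (Unique.allFin⁺ s) (∈-allFin T₀) only-T₀ ⟩
    layer-count p T₀                         ≡⟨ layer-count≡1 p h₀ p₀ (λ h pi → cong proj₁ (unique h pi)) ⟩
    1                                        ∎
    where
    open ≡-Reasoning
    only-T₀ : ∀ {T} → T ∈ allFin s → layer-count p T ≢ 0 → T ≡ T₀
    only-T₀ _ ≢0 = let _ , h , pi = layer-count≢0 p ≢0 in cong proj₂ (unique h pi)

  count-E≡s : ∀ p → (∀ T → layer-count p T ≡ 1) → count p E ≡ s
  count-E≡s p one-per-layer = begin
    count p E                             ≡⟨ count-E p ⟩
    sum (map (layer-count p) (allFin s))  ≡⟨ sum-map-cong (allFin s) (λ {T} _ → one-per-layer T) ⟩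
    count (λ _ → true) (allFin s)         ≡⟨ count-≡length (allFin s) (λ _ → refl) ⟩
    length (allFin s)                     ≡⟨ List.length-tabulate (λ T → T) ⟩
    s                                     ∎
    where open ≡-Reasoning

  step-injective : ∀ {x y} → HasEdge x → HasEdge y → step x ≡ step y → x ≡ y
  step-injective {i , T} {i′ , U} (B≤ , _) (B≤′ , _) eq with refl ← nxt-injective {T} {U} (cong proj₂ eq) =
    cong (λ i″ → (i″ , T)) (ℕ.+-cancelʳ-≡ (A T) i i′ (ℕ.∸-cancelʳ-≡ B≤ B≤′ (cong proj₁ eq)))

  outdeg-HasEdge : ∀ {x} → HasEdge x → outdeg E (emb x) ≡ 1
  outdeg-HasEdge {x} h = count-E≡1 _ h (≡⇒veq (src-edgeFrom x))
    (λ {y} _ yx → emb-injective (trans (sym (src-edgeFrom y)) (veq⇒≡ yx)))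

  outdeg≡1⇒HasEdge : ∀ {x} → outdeg E (emb x) ≡ 1 → HasEdge x
  outdeg≡1⇒HasEdge {x} out≡1 =
    decidable-stable (hasEdge? x) λ ¬h →
      ℕ.1+n≢0 (trans (sym out≡1) (count-≡0 E (λ e∈ → Bool.¬-not (not-out ¬h e∈))))
    where
    not-out : ¬ HasEdge x → ∀ {e} → e ∈ E → veq (src e) (emb x) ≢ true
    not-out ¬h e∈ ex with y , hy , refl ← ∈E⁻ e∈ =
      ¬h (subst HasEdge (emb-injective (trans (sym (src-edgeFrom y)) (veq⇒≡ ex))) hy)

  indeg-step : ∀ {x} → HasEdge x → indeg E (emb (step x)) ≡ 1
  indeg-step {x} h = count-E≡1 _ h (≡⇒veq {emb (step x)} refl)
    (λ {y} hy yx → step-injective hy h (emb-injective (veq⇒≡ {emb (step y)} yx)))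

  drift : Fin s → ℤ
  drift T = + A T ℤ.- + B T

  offset : ℕ → ℤ
  offset zero = + 0
  offset (suc t) = offset t ℤ.+ drift (t mod s)

  D : ℤ
  D = offset s

  level : Vertex → ℤ
  level (i , t) = + i ℤ.- offset t

  lev : Point → ℤ
  lev x = level (emb x)

  sub-add-cancel : ∀ (a c : ℤ) → a ≡ (a ℤ.- c) ℤ.+ c
  sub-add-cancel = solve-∀

  level-injective : ∀ {i i′ t} → level (i , t) ≡ level (i′ , t) → i ≡ i′
  level-injective {i} {i′} {t} eq = ℤ.+-injective (begin
    + i                          ≡⟨ sub-add-cancel (+ i) (offset t) ⟩
    level (i , t) ℤ.+ offset t   ≡⟨ cong (λ z → z ℤ.+ offset t) eq ⟩
    level (i′ , t) ℤ.+ offset t  ≡⟨ sub-add-cancel (+ i′) (offset t) ⟨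
    + i′                         ∎)
    where open ≡-Reasoning

  same-layer-level⇒≡ : ∀ {x y} → proj₂ x ≡ proj₂ y → lev x ≡ lev y → x ≡ y
  same-layer-level⇒≡ {i , T} {i′ , .T} refl eq = cong (λ i″ → (i″ , T)) (level-injective {t = toℕ T} eq)

  step-index : ∀ {i T} → B T ≤ i + A T → + (i + A T ∸ B T) ≡ + i ℤ.+ drift T
  step-index {i} {T} B≤ = begin
    + (i + A T ∸ B T)           ≡⟨ ℤ.⊖-≥ B≤ ⟨
    (i + A T) ℤ.⊖ B T           ≡⟨ ℤ.m-n≡m⊖n (i + A T) (B T) ⟨
    (+ i ℤ.+ + A T) ℤ.- + B T   ≡⟨ ℤ.+-assoc (+ i) (+ A T) (- + B T) ⟩
    + i ℤ.+ drift T             ∎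
    where open ≡-Reasoning

  level-step : ∀ {x} → HasEdge x → toℕ (proj₂ x) < n → lev (step x) ≡ lev x
  level-step {i , T} (B≤ , _) T<n = begin
    + (i + A T ∸ B T) ℤ.- offset (toℕ (nxt n T))
      ≡⟨ cong₂ ℤ._-_ (step-index B≤) (cong offset (toℕ-nxt T<n)) ⟩
    (+ i ℤ.+ drift T) ℤ.- (offset (toℕ T) ℤ.+ drift (toℕ T mod s))
      ≡⟨ cong (λ U → (+ i ℤ.+ drift T) ℤ.- (offset (toℕ T) ℤ.+ drift U)) (mod-toℕ T) ⟩
    (+ i ℤ.+ drift T) ℤ.- (offset (toℕ T) ℤ.+ drift T)
      ≡⟨ cancel (+ i) (drift T) (offset (toℕ T)) ⟩
    + i ℤ.- offset (toℕ T) ∎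
    where
    open ≡-Reasoning
    cancel : ∀ (a b c : ℤ) → (a ℤ.+ b) ℤ.- (c ℤ.+ b) ≡ a ℤ.- c
    cancel = solve-∀

  level-step-last : ∀ {x} → HasEdge x → toℕ (proj₂ x) ≡ n → lev (step x) ≡ lev x ℤ.+ D
  level-step-last {i , T} (B≤ , _) T≡n = begin
    + (i + A T ∸ B T) ℤ.- offset (toℕ (nxt n T))
      ≡⟨ cong₂ ℤ._-_ (step-index B≤) (cong offset (toℕ-nxt-last T≡n)) ⟩
    (+ i ℤ.+ drift T) ℤ.- + 0
      ≡⟨ regroup (+ i) (drift T) (offset (toℕ T)) ⟩
    (+ i ℤ.- offset (toℕ T)) ℤ.+ (offset (toℕ T) ℤ.+ drift T)
      ≡⟨ cong (λ U → (+ i ℤ.- offset (toℕ T)) ℤ.+ (offset (toℕ T) ℤ.+ drift U)) (mod-toℕ T) ⟨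
    (+ i ℤ.- offset (toℕ T)) ℤ.+ offset (suc (toℕ T))
      ≡⟨ cong (λ t → (+ i ℤ.- offset (toℕ T)) ℤ.+ offset (suc t)) T≡n ⟩
    (+ i ℤ.- offset (toℕ T)) ℤ.+ D ∎
    where
    open ≡-Reasoning
    regroup : ∀ (a b c : ℤ) → (a ℤ.+ b) ℤ.- + 0 ≡ (a ℤ.- c) ℤ.+ (c ℤ.+ b)
    regroup = solve-∀

  walk : ℕ → Point → Point
  walk zero x = x
  walk (suc k) x = walk k (step x)

  Path : ℕ → Point → Set
  Path k x = ∀ j → j < k → HasEdge (walk j x)

  path-head : ∀ {k x} → Path (suc k) x → HasEdge x
  path-head path = path 0 (s≤s z≤n)

  path-tail : ∀ {k x} → Path (suc k) x → Path k (step x)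
  path-tail path j j<k = path (suc j) (s≤s j<k)

  path-cons : ∀ {k x} → HasEdge x → Path k (step x) → Path (suc k) x
  path-cons h path zero _ = h
  path-cons h path (suc j) (s≤s j<k) = path j j<k

  path-snoc : ∀ {k x} → Path k x → HasEdge (walk k x) → Path (suc k) x
  path-snoc {k} path h j j<1+k with ℕ.m≤n⇒m<n∨m≡n (ℕ.<⇒≤pred j<1+k)
  ... | inj₁ j<k = path j j<k
  ... | inj₂ refl = h

  path-mono : ∀ {k k′ x} → k ≤ k′ → Path k′ x → Path k x
  path-mono k≤k′ path j j<k = path j (ℕ.<-≤-trans j<k k≤k′)

  walk-index< : ∀ k {x} → Path k x → proj₁ x < m → proj₁ (walk k x) < m
  walk-index< zero _ x<m = x<m
  walk-index< (suc k) path _ = walk-index< k (path-tail path) (step-index< (path-head path))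

  reach-walk : ∀ k {x} → Path k x → proj₁ x < m → reach E V k (emb x) (emb (walk k x)) ≡ true
  reach-walk zero {x} _ _ = ≡⇒veq {emb x} refl
  reach-walk (suc k) {x} path _ =
    reach-cons {k} {emb x} {emb (step x)} {emb (walk (suc k) x)}
               (adjacent-step (path-head path)) (∈V⁺ (step-index< (path-head path)))
               (reach-walk k (path-tail path) (step-index< (path-head path)))

  walk-winding : ∀ k x → Path k x → ∃ λ w → w * s + toℕ (proj₂ (walk k x)) ≡ toℕ (proj₂ x) + k
                                            × lev (walk k x) ≡ lev x ℤ.+ + w ℤ.* D
  walk-winding zero x _ = 0 , sym (ℕ.+-identityʳ _) , sym (no-laps (lev x) D)
    where
    no-laps : ∀ (a δ : ℤ) → a ℤ.+ + 0 ℤ.* δ ≡ a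
    no-laps = solve-∀
  walk-winding (suc k) (i , T) path with walk-winding k (step (i , T)) (path-tail path) | inner-or-last T
  ... | w , layers , levels | inj₁ T<n =
    w , trans layers (trans (cong (λ t → t + k) (toℕ-nxt T<n)) (sym (ℕ.+-suc (toℕ T) k))) ,
    trans levels (cong (λ z → z ℤ.+ + w ℤ.* D) (level-step (path-head path) T<n))
  ... | w , layers , levels | inj₂ T≡n =
    suc w , lap-layers ,
    trans levels (trans (cong (λ z → z ℤ.+ + w ℤ.* D) (level-step-last (path-head path) T≡n))
                        (one-more-lap (lev (i , T)) (+ w) D))
    where
    one-more-lap : ∀ (a w δ : ℤ) → (a ℤ.+ δ) ℤ.+ w ℤ.* δ ≡ a ℤ.+ (+ 1 ℤ.+ w) ℤ.* δ
    one-more-lap = solve-∀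
    rest : ℕ
    rest = toℕ (proj₂ (walk k (step (i , T))))
    lap-layers : suc w * s + rest ≡ toℕ T + suc k
    lap-layers = begin
      s + w * s + rest    ≡⟨ ℕ.+-assoc s (w * s) rest ⟩
      s + (w * s + rest)  ≡⟨ cong (λ t → s + t) (trans layers (cong (λ t → t + k) (toℕ-nxt-last T≡n))) ⟩
      suc n + k           ≡⟨ ℕ.+-suc n k ⟨
      n + suc k           ≡⟨ cong (λ t → t + suc k) T≡n ⟨
      toℕ T + suc k       ∎
      where open ≡-Reasoning

  walk-layer : ∀ {k x w U} → Path k x → w * s + toℕ U ≡ toℕ (proj₂ x) + k → proj₂ (walk k x) ≡ U
  walk-layer {k} {x} {w} {U} path eq with laps , layers , _ ← walk-winding k x path =
    Fin.toℕ-injective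
      (proj₂ (quotient-remainder-unique {w = laps} {w′ = w} (trans layers (sym eq)) (Fin.toℕ<n _) (Fin.toℕ<n U)))

  -- sameComp only sees walks of length at most length V = m * s, hence the bound on k.
  circular-path : ∀ {x} → circularComp V E (emb x) ≡ true → proj₁ x < m → ∀ k → k ≤ m * s → Path k x
  circular-path c x<m zero _ j ()
  circular-path {x} c x<m (suc k) k<ms =
    path-snoc path (outdeg≡1⇒HasEdge (proj₂ (circularComp⇒degrees c end∈V x-end)))
    where
    path : Path k x
    path = circular-path c x<m k (ℕ.<⇒≤ k<ms)
    end∈V : emb (walk k x) ∈ V
    end∈V = ∈V⁺ (walk-index< k path x<m)
    x-end : sameComp V E (emb x) (emb (walk k x)) ≡ true
    x-end = reach-mono (subst (k ≤_) (sym (length-vertices m s)) (ℕ.<⇒≤ k<ms)) (reach-walk k path x<m)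

  no-positive-drift : ∀ {i i′ d} → + i′ ≡ + i ℤ.+ + m ℤ.* + suc d → ¬ i′ < m
  no-positive-drift {i} {i′} {d} eq =
    ℕ.≤⇒≯ (subst (m ≤_) (sym i′≡) (ℕ.≤-trans (ℕ.m≤m*n m (suc d)) (ℕ.m≤n+m _ i)))
    where
    i′≡ : i′ ≡ i + m * suc d
    i′≡ = ℤ.+-injective (trans eq (cong (λ z → + i ℤ.+ z) (sym (ℤ.pos-* m (suc d)))))

  bounded-drift-zero : ∀ {i i′} (δ : ℤ) → i < m → i′ < m → + i′ ≡ + i ℤ.+ + m ℤ.* δ → δ ≡ + 0
  bounded-drift-zero (+ zero) _ _ _ = refl
  bounded-drift-zero (+ suc d) _ i′<m eq = contradiction i′<m (no-positive-drift eq)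
  bounded-drift-zero {i} {i′} ℤ.-[1+ d ] i<m _ eq = contradiction i<m (no-positive-drift (begin
    + i                                               ≡⟨ undo (+ i) (+ m) (+ suc d) ⟨
    (+ i ℤ.+ + m ℤ.* - + suc d) ℤ.+ + m ℤ.* + suc d   ≡⟨ cong (λ z → z ℤ.+ + m ℤ.* + suc d) eq ⟨
    + i′ ℤ.+ + m ℤ.* + suc d                          ∎))
    where
    open ≡-Reasoning
    undo : ∀ (a b c : ℤ) → (a ℤ.+ b ℤ.* - c) ℤ.+ b ℤ.* c ≡ a
    undo = solve-∀

  long-walk⇒balanced : ∀ {i T} → i < m → Path (m * s) (i , T) → D ≡ + 0
  long-walk⇒balanced {i} {T} i<m path
    with w , layers , levels ← walk-winding (m * s) (i , T) path
    with refl , same-layer ← quotient-remainder-unique {w = w} {w′ = m} (trans layers (ℕ.+-comm (toℕ T) (m * s)))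
                                                       (Fin.toℕ<n _) (Fin.toℕ<n T)
    = bounded-drift-zero D i<m (walk-index< (m * s) path i<m) (begin
      + proj₁ end                                     ≡⟨ sub-add-cancel (+ proj₁ end) (offset (toℕ (proj₂ end))) ⟩
      lev end ℤ.+ offset (toℕ (proj₂ end))            ≡⟨ cong₂ ℤ._+_ levels (cong offset same-layer) ⟩
      (lev (i , T) ℤ.+ + m ℤ.* D) ℤ.+ offset (toℕ T)  ≡⟨ regroup (+ i) (offset (toℕ T)) (+ m ℤ.* D) ⟩
      + i ℤ.+ + m ℤ.* D                               ∎)
    where
    open ≡-Reasoning
    end : Point
    end = walk (m * s) (i , T)
    regroup : ∀ (a c δ : ℤ) → ((a ℤ.- c) ℤ.+ δ) ℤ.+ c ≡ a ℤ.+ δ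
    regroup = solve-∀

  circular⇒balanced : ∀ {x} → circularComp V E (emb x) ≡ true → proj₁ x < m → D ≡ + 0
  circular⇒balanced c x<m = long-walk⇒balanced x<m (circular-path c x<m (m * s) ℕ.≤-refl)

  module Balanced (balanced : D ≡ + 0) where

    level-step≡ : ∀ {x} → HasEdge x → lev (step x) ≡ lev x
    level-step≡ {x} h with inner-or-last (proj₂ x)
    ... | inj₁ inner = level-step h inner
    ... | inj₂ last =
      trans (level-step-last h last) (trans (cong (λ δ → lev x ℤ.+ δ) balanced) (ℤ.+-identityʳ (lev x)))

    walk-level : ∀ k {x} → Path k x → lev (walk k x) ≡ lev x
    walk-level zero _ = refl
    walk-level (suc k) path = trans (walk-level k (path-tail path)) (level-step≡ (path-head path))

    sameComp⇒level≡ : ∀ {u v} → sameComp V E u v ≡ true → level u ≡ level v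
    sameComp⇒level≡ = reach-invariant level adjacent⇒level≡ (length V)
      where
      adjacent⇒level≡ : ∀ {u v} → adjacent E u v ≡ true → level u ≡ level v
      adjacent⇒level≡ uv with adjacent⇒step uv
      ... | x , h , inj₁ (refl , refl) = sym (level-step≡ h)
      ... | x , h , inj₂ (refl , refl) = level-step≡ h

    walk-to-layer : ∀ x U → ∃ λ k → k < s × (Path k x → proj₂ (walk k x) ≡ U)
    walk-to-layer (i , T) U with k , k<s , w , gap ← residue-gap (Fin.toℕ<n T) (Fin.toℕ<n U) =
      k , k<s , λ path → walk-layer {w = w} path gap

    1+k≤m*s : ∀ {k i} → k < s → i < m → suc k ≤ m * s
    1+k≤m*s {k} {i} k<s i<m = ℕ.≤-trans k<s (ℕ.m≤n*m s m {{ℕ.>-nonZero (ℕ.≤-<-trans z≤n i<m)}})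

    CycleLevel : ℤ → Set
    CycleLevel ℓ = ∀ T → ∃ λ i → lev (i , T) ≡ ℓ × HasEdge (i , T)

    cycleLevel-HasEdge : ∀ {ℓ x} → CycleLevel ℓ → lev x ≡ ℓ → HasEdge x
    cycleLevel-HasEdge {ℓ} {i , T} cycle lx with i₀ , l₀ , h₀ ← cycle T =
      subst HasEdge (same-layer-level⇒≡ refl (trans l₀ (sym lx))) h₀

    cycleLevel-path : ∀ {ℓ} → CycleLevel ℓ → ∀ k {x} → lev x ≡ ℓ → Path k x
    cycleLevel-path cycle zero _ j ()
    cycleLevel-path cycle (suc k) {x} lx = path-cons h (cycleLevel-path cycle k (trans (level-step≡ h) lx))
      where
      h : HasEdge x
      h = cycleLevel-HasEdge cycle lx

    cycleLevel-predecessor : ∀ {ℓ y} → CycleLevel ℓ → lev y ≡ ℓ → ∃ λ x → HasEdge x × step x ≡ y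
    cycleLevel-predecessor {y = i , U} cycle ly with T , T↦U ← nxt-surjective U with i₀ , l₀ , h₀ ← cycle T =
      (i₀ , T) , h₀ , same-layer-level⇒≡ T↦U (trans (level-step≡ h₀) (trans l₀ (sym ly)))

    cycleLevel⇒circular : ∀ {x} → CycleLevel (lev x) → circularComp V E (emb x) ≡ true
    cycleLevel⇒circular {x} cycle = degrees⇒circularComp component-degrees
      where
      component-degrees : ∀ {u} → u ∈ V → sameComp V E (emb x) u ≡ true → indeg E u ≡ 1 × outdeg E u ≡ 1
      component-degrees u∈ xu with y , _ , refl ← ∈V⁻ u∈ =
        let ly = sym (sameComp⇒level≡ xu)
            p , hp , p↦y = cycleLevel-predecessor cycle ly
        in subst (λ z → indeg E (emb z) ≡ 1) p↦y (indeg-step hp) , outdeg-HasEdge (cycleLevel-HasEdge cycle ly)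

    circular⇒cycleLevel : ∀ {x} → circularComp V E (emb x) ≡ true → proj₁ x < m → CycleLevel (lev x)
    circular⇒cycleLevel {x} c x<m U with k , k<s , lands ← walk-to-layer x U =
      let path = circular-path c x<m (suc k) (1+k≤m*s k<s x<m)
          first-k = path-mono (ℕ.n≤1+n k) path
          at-U = lands first-k
      in proj₁ (walk k x) ,
         subst (λ T → lev (proj₁ (walk k x) , T) ≡ lev x) at-U (walk-level k first-k) ,
         subst (λ T → HasEdge (proj₁ (walk k x) , T)) at-U (path k (ℕ.n<1+n k))

    cycleLevel-connected : ∀ {ℓ x y} → CycleLevel ℓ → lev x ≡ ℓ → lev y ≡ ℓ → proj₁ x < m →
                           sameComp V E (emb x) (emb y) ≡ true
    cycleLevel-connected {ℓ} {x} {y} cycle lx ly x<m with k , k<s , lands ← walk-to-layer x (proj₂ y) =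
      reach-mono (subst (k ≤_) (sym (length-vertices m s)) (ℕ.<⇒≤ (1+k≤m*s k<s x<m)))
                 (subst (λ z → reach E V k (emb x) (emb z) ≡ true) end≡y (reach-walk k path x<m))
      where
      path : Path k x
      path = cycleLevel-path cycle k lx
      end≡y : walk k x ≡ y
      end≡y = same-layer-level⇒≡ (lands path) (trans (walk-level k path) (trans lx (sym ly)))

    level-layer0 : ∀ i → lev (i , Fin.zero) ≡ + i
    level-layer0 i = ℤ.+-identityʳ (+ i)

    cycleLevel-key : ∀ {ℓ} → CycleLevel ℓ → ℓ ∈ map +_ (upTo m)
    cycleLevel-key cycle with i , li , h ← cycle Fin.zero =
      subst (_∈ map +_ (upTo m)) (trans (sym (level-layer0 i)) li) (∈-map⁺ +_ (∈-upTo⁺ (source-index< h)))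

    cycleLevel? : ∀ {l} → l < m → Dec (CycleLevel (+ l))
    cycleLevel? {l} l<m with circularComp V E (emb (l , Fin.zero)) in c
    ... | true = yes (subst CycleLevel (level-layer0 l) (circular⇒cycleLevel c l<m))
    ... | false = no λ cycle →
      contradiction (trans (sym c) (cycleLevel⇒circular (subst CycleLevel (sym (level-layer0 l)) cycle))) λ ()

    circularAt : ℤ → Vertex → Bool
    circularAt ℓ v = circularComp V E v ∧ does (level v ℤ.≟ ℓ)

    circularAt⇒ : ∀ {ℓ x} → circularAt ℓ (emb x) ≡ true → proj₁ x < m → CycleLevel ℓ
    circularAt⇒ {ℓ} {x} cx x<m with c , lx ← ∧-true⁻ {circularComp V E (emb x)} cx
      with refl ← does-true⁻ (lev x ℤ.≟ ℓ) lx = circular⇒cycleLevel c x<m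

    circularAt⁺ : ∀ {ℓ x} → CycleLevel ℓ → lev x ≡ ℓ → circularAt ℓ (emb x) ≡ true
    circularAt⁺ {x = x} cycle refl = cong₂ _∧_ (cycleLevel⇒circular cycle) (dec-true (lev x ℤ.≟ lev x) refl)

    circularAt-level : ∀ {ℓ v} → circularAt ℓ v ≡ true → level v ≡ ℓ
    circularAt-level {ℓ} {v} cv = does-true⁻ (level v ℤ.≟ ℓ) (proj₂ (∧-true⁻ {circularComp V E v} cv))

    circular-edges-at : ℤ → ℕ
    circular-edges-at ℓ = count (λ e → circularAt ℓ (src e)) E

    representatives-at : ℤ → ℕ
    representatives-at ℓ = count (λ v → (isRep V E v ∧ circularComp V E v) ∧ does (level v ℤ.≟ ℓ)) V

    circular-edges-at-cycleLevel : ∀ {ℓ} → CycleLevel ℓ → circular-edges-at ℓ ≡ s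
    circular-edges-at-cycleLevel {ℓ} cycle = count-E≡s _ one-per-layer
      where
      at-source : ∀ x → circularAt ℓ (src (edgeFrom x)) ≡ circularAt ℓ (emb x)
      at-source x = cong (circularAt ℓ) (src-edgeFrom x)
      one-per-layer : ∀ T → layer-count (λ e → circularAt ℓ (src e)) T ≡ 1
      one-per-layer T with i , li , h ← cycle T =
        layer-count≡1 _ h (trans (at-source (i , T)) (circularAt⁺ cycle li)) λ {i′} _ ci′ →
          level-injective {t = toℕ T} (trans (circularAt-level (trans (sym (at-source (i′ , T))) ci′)) (sym li))

    circular-edges-off-cycleLevel : ∀ {ℓ} → ¬ CycleLevel ℓ → circular-edges-at ℓ ≡ 0
    circular-edges-off-cycleLevel {ℓ} ¬cycle = count-≡0 E (λ e∈ → Bool.¬-not (not-circular e∈))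
      where
      not-circular : ∀ {e} → e ∈ E → circularAt ℓ (src e) ≢ true
      not-circular e∈ ce with x , h , refl ← ∈E⁻ e∈ =
        ¬cycle (circularAt⇒ (trans (sym (cong (circularAt ℓ) (src-edgeFrom x))) ce) (source-index< h))

    representatives-at-cycleLevel : ∀ {ℓ} → CycleLevel ℓ → representatives-at ℓ ≡ 1
    representatives-at-cycleLevel {ℓ} cycle = begin
      representatives-at ℓ                          ≡⟨ count-cong V (λ {v} _ → Bool.∧-assoc (isRep V E v) _ _) ⟩
      count (λ v → isRep V E v ∧ circularAt ℓ v) V  ≡⟨ count-representatives (vertices-unique m s) (circularAt ℓ)
                                                                             nonempty connected closed ⟩
      1                                             ∎
      where
      open ≡-Reasoning
      nonempty : Any (λ v → circularAt ℓ v ≡ true) V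
      nonempty with i , li , h ← cycle Fin.zero =
        lose (∈V⁺ (source-index< h)) (circularAt⁺ {x = i , Fin.zero} cycle li)
      connected : ∀ {u v} → u ∈ V → v ∈ V → circularAt ℓ u ≡ true → circularAt ℓ v ≡ true →
                  sameComp V E u v ≡ true
      connected u∈ v∈ cu cv with x , x<m , refl ← ∈V⁻ u∈ | y , _ , refl ← ∈V⁻ v∈ =
        cycleLevel-connected cycle (circularAt-level cu) (circularAt-level cv) x<m
      closed : ∀ {u v} → u ∈ V → v ∈ V → circularAt ℓ u ≡ true → sameComp V E u v ≡ true →
               circularAt ℓ v ≡ true
      closed _ v∈ cu uv with y , _ , refl ← ∈V⁻ v∈ =
        circularAt⁺ cycle (trans (sym (sameComp⇒level≡ uv)) (circularAt-level cu))

    representatives-off-cycleLevel : ∀ {ℓ} → ¬ CycleLevel ℓ → representatives-at ℓ ≡ 0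
    representatives-off-cycleLevel {ℓ} ¬cycle = count-≡0 V (λ v∈ → Bool.¬-not (not-representative v∈))
      where
      not-representative : ∀ {v} → v ∈ V → (isRep V E v ∧ circularComp V E v) ∧ does (level v ℤ.≟ ℓ) ≢ true
      not-representative {v} v∈ rcv with x , x<m , refl ← ∈V⁻ v∈ =
        let rep∧cx = trans (sym (Bool.∧-assoc (isRep V E v) _ _)) rcv
        in ¬cycle (circularAt⇒ (proj₂ (∧-true⁻ {isRep V E v} rep∧cx)) x<m)

    circular-edges≡s*representatives : ∀ {ℓ} → ℓ ∈ map +_ (upTo m) →
                                       circular-edges-at ℓ ≡ s * representatives-at ℓ
    circular-edges≡s*representatives ℓ∈ with l , l∈ , refl ← ∈-map⁻ +_ ℓ∈ with cycleLevel? (∈-upTo⁻ l∈)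
    ... | yes cycle = trans (circular-edges-at-cycleLevel cycle)
                            (sym (trans (cong (s *_) (representatives-at-cycleLevel cycle)) (ℕ.*-identityʳ s)))
    ... | no ¬cycle = trans (circular-edges-off-cycleLevel ¬cycle)
                            (sym (trans (cong (s *_) (representatives-off-cycleLevel ¬cycle)) (ℕ.*-zeroʳ s)))

    w≡c*s : wΓ m n ε ≡ cΓ m n ε * s
    w≡c*s = begin
      wΓ m n ε                                         ≡⟨ count-fibres ℤ._≟_ (λ e → level (src e)) keys! _ E edge-key ⟩
      sum (map circular-edges-at keys)                 ≡⟨ sum-map-cong keys circular-edges≡s*representatives ⟩
      sum (map (λ ℓ → s * representatives-at ℓ) keys)  ≡⟨ sum-map-*ˡ keys s representatives-at ⟩
      s * sum (map representatives-at keys)            ≡⟨ cong (s *_) (count-fibres ℤ._≟_ level keys! _ V vertex-key) ⟨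
      s * cΓ m n ε                                     ≡⟨ ℕ.*-comm s (cΓ m n ε) ⟩
      cΓ m n ε * s                                     ∎
      where
      open ≡-Reasoning
      keys : List ℤ
      keys = map +_ (upTo m)
      keys! : Unique keys
      keys! = Unique.map⁺ ℤ.+-injective (Unique.upTo⁺ m)
      edge-key : ∀ {e} → e ∈ E → circularComp V E (src e) ≡ true → level (src e) ∈ keys
      edge-key e∈ c with x , h , refl ← ∈E⁻ e∈ =
        subst (λ v → level v ∈ keys) (sym (src-edgeFrom x))
              (cycleLevel-key (circular⇒cycleLevel (subst (λ v → circularComp V E v ≡ true) (src-edgeFrom x) c)
                                                   (source-index< h)))
      vertex-key : ∀ {v} → v ∈ V → isRep V E v ∧ circularComp V E v ≡ true → level v ∈ keys
      vertex-key v∈ rc with x , x<m , refl ← ∈V⁻ v∈ =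
        cycleLevel-key (circular⇒cycleLevel (proj₂ (∧-true⁻ {isRep V E (emb x)} rc)) x<m)

  w≡c*s : wΓ m n ε ≡ cΓ m n ε * s
  w≡c*s with D ℤ.≟ + 0
  ... | yes balanced = Balanced.w≡c*s balanced
  ... | no unbalanced = trans (count-≡0 E (λ e∈ → Bool.¬-not (no-circular-edge e∈)))
                              (cong (λ c → c * s) (sym (count-≡0 V (λ v∈ → Bool.¬-not (no-circular-vertex v∈)))))
    where
    no-circular-edge : ∀ {e} → e ∈ E → circularComp V E (src e) ≢ true
    no-circular-edge e∈ c with x , h , refl ← ∈E⁻ e∈ =
      unbalanced (circular⇒balanced (subst (λ v → circularComp V E v ≡ true) (src-edgeFrom x) c) (source-index< h))
    no-circular-vertex : ∀ {v} → v ∈ V → isRep V E v ∧ circularComp V E v ≢ true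
    no-circular-vertex v∈ rc with x , x<m , refl ← ∈V⁻ v∈ =
      unbalanced (circular⇒balanced (proj₂ (∧-true⁻ {isRep V E (emb x)} rc)) x<m)

corollary3p4 : (m n : ℕ) → 1 ≤ m → (ε : Fin (suc n) → ℤ) →
    wΓ m n ε ≡ cΓ m n ε * suc n
corollary3p4 m (suc k) _ ε = LongSequence.w≡c*s m k ε
corollary3p4 m zero _ ε with ε Fin.zero
... | ℤ.+ zero = SingleTerm.with-loops m
... | ℤ.+ suc _ = SingleTerm.no-edges m
... | ℤ.-[1+ _ ] = SingleTerm.no-edges m
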